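{- Let $X$ be a rack and let $\mathcal T_2=\{0,1\}$ be the trivial rack on two elements. Then the pair $(X,\mathcal T_2)$ is productive, i.e. the homomorphism of commutator subgroups $[\Gamma_{X\times\mathcal T_2},\Gamma_{X\times\mathcal T_2}]\to[\Gamma_X,\Gamma_X]\times[\Gamma_{\mathcal T_2},\Gamma_{\mathcal T_2}]$ induced by the two projections is injective.
   Context: A rack is a set $X$ with a binary operation $(x,y)\mapsto x^y$ such that each $x\mapsto x^y$ is a bijection and $(z^x)^y=(z^y)^{x^y}$. The trivial rack $\mathcal T_2$ has $a^b=a$. Products of racks have componentwise operation. The structure group of a rack $Z$ is $\Gamma_Z=\langle Z\mid y^{ -1}xy=x^y\ \forall x,y\in Z\rangle$, functorial in rack morphisms. -}

module Defs where

open import Level using (Level; _⊔_; suc)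
open import Data.Bool using (Bool)
open import Data.Product using (_×_; _,_; proj₁; proj₂)
open import Relation.Binary.PropositionalEquality using (_≡_)
open import Function.Definitions using (Bijective)

record Rack (a : Level) : Set (suc a) where
  infixl 8 _^_
  field
    Carrier : Set a
    _^_     : Carrier → Carrier → Carrier
    ^-bij   : ∀ y → Bijective _≡_ _≡_ (λ x → x ^ y)
    ^-dist  : ∀ x y z → (z ^ x) ^ y ≡ (z ^ y) ^ (x ^ y)

open Rack public using (Carrier)

trivialRack₂ : Rack Level.zero
trivialRack₂ = record
  { Carrier = Bool
  ; _^_     = λ a b → a
  ; ^-bij   = λ y → (λ eq → eq) , (λ x → x , λ eq → eq)
  ; ^-dist  = λ x y z → _≡_.refl
  }
  where open import Relation.Binary.PropositionalEquality

_×ᴿ_ : ∀ {a b} → Rack a → Rack b → Rack (a ⊔ b)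
X ×ᴿ Y = record
  { Carrier = Carrier X × Carrier Y
  ; _^_     = λ { (x₁ , y₁) (x₂ , y₂) → Rack._^_ X x₁ x₂ , Rack._^_ Y y₁ y₂ }
  ; ^-bij   = λ { (x₂ , y₂) →
        (λ { {a₁ , b₁} {a₂ , b₂} eq →
               cong₂ _,_ (proj₁ (Rack.^-bij X x₂) (cong proj₁ eq))
                         (proj₁ (Rack.^-bij Y y₂) (cong proj₂ eq)) })
      , (λ { (a , b) →
               let (a' , ea) = proj₂ (Rack.^-bij X x₂) a
                   (b' , eb) = proj₂ (Rack.^-bij Y y₂) b
               in (a' , b') , λ { refl → cong₂ _,_ (ea refl) (eb refl) } }) }
  ; ^-dist  = λ { (x₁ , y₁) (x₂ , y₂) (x₃ , y₃) →
        cong₂ _,_ (Rack.^-dist X x₁ x₂ x₃) (Rack.^-dist Y y₁ y₂ y₃) }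
  }
  where
  open import Relation.Binary.PropositionalEquality

infixl 7 _·_
data Word {a} (A : Set a) : Set a where
  gen : A → Word A
  ε   : Word A
  _·_ : Word A → Word A → Word A
  _⁻¹ : Word A → Word A

mapWord : ∀ {a b} {A : Set a} {B : Set b} → (A → B) → Word A → Word B
mapWord f (gen x) = gen (f x)
mapWord f ε = ε
mapWord f (u · v) = mapWord f u · mapWord f v
mapWord f (u ⁻¹) = (mapWord f u) ⁻¹

-- The structure group Γ_Z = ⟨ Z | y⁻¹ x y = x^y ⟩, presented as the setoid of
-- words modulo the least congruence containing the group axioms and the relations.
module _ {a} (Z : Rack a) where
  open Rack Z using (_^_)
  infix 4 _≈Γ_
  data _≈Γ_ : Word (Carrier Z) → Word (Carrier Z) → Set a where
    ≈refl  : ∀ {u} → u ≈Γ u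
    ≈sym   : ∀ {u v} → u ≈Γ v → v ≈Γ u
    ≈trans : ∀ {u v w} → u ≈Γ v → v ≈Γ w → u ≈Γ w
    ·-cong : ∀ {u u' v v'} → u ≈Γ u' → v ≈Γ v' → u · v ≈Γ u' · v'
    ⁻¹-cong : ∀ {u v} → u ≈Γ v → u ⁻¹ ≈Γ v ⁻¹
    assoc  : ∀ u v w → (u · v) · w ≈Γ u · (v · w)
    idˡ    : ∀ u → ε · u ≈Γ u
    idʳ    : ∀ u → u · ε ≈Γ u
    invˡ   : ∀ u → u ⁻¹ · u ≈Γ ε
    invʳ   : ∀ u → u · u ⁻¹ ≈Γ ε
    rack-rel : ∀ x y → (gen y) ⁻¹ · gen x · gen y ≈Γ gen (x ^ y)

  data InCommutator : Word (Carrier Z) → Set a where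
    comm  : ∀ u v → InCommutator (u ⁻¹ · v ⁻¹ · u · v)
    c-ε   : InCommutator ε
    c-·   : ∀ {u v} → InCommutator u → InCommutator v → InCommutator (u · v)
    c-⁻¹  : ∀ {u} → InCommutator u → InCommutator (u ⁻¹)
    c-≈   : ∀ {u v} → u ≈Γ v → InCommutator u → InCommutator v

Productive : ∀ {a b} → Rack a → Rack b → Set (a ⊔ b)
Productive X Y =
  ∀ (u v : Word (Carrier X × Carrier Y)) →
  InCommutator (X ×ᴿ Y) u → InCommutator (X ×ᴿ Y) v →
  _≈Γ_ X (mapWord proj₁ u) (mapWord proj₁ v) →
  _≈Γ_ Y (mapWord proj₂ u) (mapWord proj₂ v) →
  _≈Γ_ (X ×ᴿ Y) u v

{-# OPTIONS --safe #-}
module Submission where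

open import Defs
  using (Rack; trivialRack₂; _×ᴿ_; Word; gen; _·_; mapWord; _≈Γ_; InCommutator; Productive)
open import Level using (Level; _⊔_)
open import Algebra.Bundles using (Group)
open import Data.Bool using (Bool; true; false)
open import Data.Product using (_×_; _,_; proj₁)
open import Function using (_∘_)
open import Relation.Binary.PropositionalEquality as ≡ using (_≡_)
import Algebra.Properties.Group as GroupProperties
import Algebra.Properties.Monoid as MonoidProperties
import Relation.Binary.Reasoning.Setoid as SetoidReasoning

-- Write x₀, x₁ for the generators (x , false), (x , true) of Γ = Γ_{X×T₂}.
-- As T₂ is trivial, x₀ and x₁ conjugate every generator to the same element,
-- so t x = x₁ x₀⁻¹ is central in Γ; conjugating by generators, the rack
-- relations give t x = t (x ^ y).  Hence x₀ ↦ 1, x₁ ↦ t x defines a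
-- homomorphism T from Γ into its centre, and every w satisfies w = T w · S w,
-- where S replaces each xᵢ by x₀.  Having abelian image, T kills [Γ,Γ], so on
-- [Γ,Γ] we get w = s (π₁ w) for the homomorphism s : Γ_X → Γ, x ↦ x₀.  Thus
-- already the first projection is injective on [Γ,Γ].

module GroupCommutation {g ℓ} (G : Group g ℓ) where
  open Group G
  open GroupProperties G using (⁻¹-anti-homo-∙; inverseʳ-unique)
  open MonoidProperties monoid using (cancelˡ; cancelʳ; insertˡ; insertʳ)
  open SetoidReasoning setoid

  Commute : Carrier → Carrier → Set ℓ
  Commute x y = x ∙ y ≈ y ∙ x

  commute-sym : ∀ {x y} → Commute x y → Commute y x
  commute-sym = sym

  commute-εʳ : ∀ x → Commute x ε
  commute-εʳ x = trans (identityʳ x) (sym (identityˡ x))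

  commute-∙ʳ : ∀ {x y z} → Commute x y → Commute x z → Commute x (y ∙ z)
  commute-∙ʳ {x} {y} {z} xy xz = begin
    x ∙ (y ∙ z) ≈⟨ sym (assoc x y z) ⟩
    (x ∙ y) ∙ z ≈⟨ ∙-congʳ xy ⟩
    (y ∙ x) ∙ z ≈⟨ assoc y x z ⟩
    y ∙ (x ∙ z) ≈⟨ ∙-congˡ xz ⟩
    y ∙ (z ∙ x) ≈⟨ sym (assoc y z x) ⟩
    (y ∙ z) ∙ x ∎

  commute-⁻¹ʳ : ∀ {x y} → Commute x y → Commute x (y ⁻¹)
  commute-⁻¹ʳ {x} {y} xy = begin
    x ∙ y ⁻¹                 ≈⟨ insertˡ (inverseˡ y) (x ∙ y ⁻¹) ⟩
    y ⁻¹ ∙ (y ∙ (x ∙ y ⁻¹))  ≈⟨ ∙-congˡ (sym (assoc y x (y ⁻¹))) ⟩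
    y ⁻¹ ∙ ((y ∙ x) ∙ y ⁻¹)  ≈⟨ ∙-congˡ (∙-congʳ (sym xy)) ⟩
    y ⁻¹ ∙ ((x ∙ y) ∙ y ⁻¹)  ≈⟨ ∙-congˡ (cancelʳ (inverseʳ y) x) ⟩
    y ⁻¹ ∙ x                 ∎

  commute-⁻¹ : ∀ {x y} → Commute x y → Commute (x ⁻¹) (y ⁻¹)
  commute-⁻¹ xy = commute-sym (commute-⁻¹ʳ (commute-sym (commute-⁻¹ʳ xy)))

  interchange : ∀ x y z w → Commute y z → (x ∙ y) ∙ (z ∙ w) ≈ (x ∙ z) ∙ (y ∙ w)
  interchange x y z w yz = begin
    (x ∙ y) ∙ (z ∙ w) ≈⟨ assoc x y (z ∙ w) ⟩
    x ∙ (y ∙ (z ∙ w)) ≈⟨ ∙-congˡ (sym (assoc y z w)) ⟩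
    x ∙ ((y ∙ z) ∙ w) ≈⟨ ∙-congˡ (∙-congʳ yz) ⟩
    x ∙ ((z ∙ y) ∙ w) ≈⟨ ∙-congˡ (assoc z y w) ⟩
    x ∙ (z ∙ (y ∙ w)) ≈⟨ sym (assoc x z (y ∙ w)) ⟩
    (x ∙ z) ∙ (y ∙ w) ∎

  commute⇒commutator≈ε : ∀ {x y} → Commute x y → x ⁻¹ ∙ y ⁻¹ ∙ x ∙ y ≈ ε
  commute⇒commutator≈ε {x} {y} xy = begin
    x ⁻¹ ∙ y ⁻¹ ∙ x ∙ y       ≈⟨ assoc (x ⁻¹ ∙ y ⁻¹) x y ⟩
    (x ⁻¹ ∙ y ⁻¹) ∙ (x ∙ y)   ≈⟨ ∙-cong (sym (⁻¹-anti-homo-∙ y x)) xy ⟩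
    (y ∙ x) ⁻¹ ∙ (y ∙ x)      ≈⟨ inverseˡ (y ∙ x) ⟩
    ε                         ∎

  conj : Carrier → Carrier → Carrier
  conj c x = c ⁻¹ ∙ x ∙ c

  conj-commute : ∀ {c x} → Commute x c → conj c x ≈ x
  conj-commute {c} {x} xc = begin
    c ⁻¹ ∙ x ∙ c    ≈⟨ assoc (c ⁻¹) x c ⟩
    c ⁻¹ ∙ (x ∙ c)  ≈⟨ ∙-congˡ xc ⟩
    c ⁻¹ ∙ (c ∙ x)  ≈⟨ cancelˡ (inverseˡ c) x ⟩
    x               ∎

  conj-∙ : ∀ c x y → conj c (x ∙ y) ≈ conj c x ∙ conj c y
  conj-∙ c x y = begin
    c ⁻¹ ∙ (x ∙ y) ∙ c                    ≈⟨ ∙-congʳ (sym (assoc (c ⁻¹) x y)) ⟩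
    (c ⁻¹ ∙ x) ∙ y ∙ c                    ≈⟨ ∙-congʳ (∙-congˡ (insertˡ (inverseʳ c) y)) ⟩
    (c ⁻¹ ∙ x) ∙ (c ∙ (c ⁻¹ ∙ y)) ∙ c     ≈⟨ ∙-congʳ (sym (assoc (c ⁻¹ ∙ x) c (c ⁻¹ ∙ y))) ⟩
    (c ⁻¹ ∙ x ∙ c) ∙ (c ⁻¹ ∙ y) ∙ c       ≈⟨ assoc (c ⁻¹ ∙ x ∙ c) (c ⁻¹ ∙ y) c ⟩
    (c ⁻¹ ∙ x ∙ c) ∙ (c ⁻¹ ∙ y ∙ c)       ∎

  conj-⁻¹ : ∀ c x → conj c (x ⁻¹) ≈ conj c x ⁻¹
  conj-⁻¹ c x = inverseʳ-unique (conj c x) (conj c (x ⁻¹)) (begin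
    conj c x ∙ conj c (x ⁻¹)  ≈⟨ sym (conj-∙ c x (x ⁻¹)) ⟩
    conj c (x ∙ x ⁻¹)         ≈⟨ ∙-congʳ (∙-congˡ (inverseʳ x)) ⟩
    conj c ε                  ≈⟨ conj-commute (commute-sym (commute-εʳ c)) ⟩
    ε                         ∎)

  conj≈conj⇒commute : ∀ {p q x} → conj p x ≈ conj q x → Commute (q ∙ p ⁻¹) x
  conj≈conj⇒commute {p} {q} {x} eq = begin
    (q ∙ p ⁻¹) ∙ x             ≈⟨ assoc q (p ⁻¹) x ⟩
    q ∙ (p ⁻¹ ∙ x)             ≈⟨ ∙-congˡ (insertʳ (inverseʳ p) (p ⁻¹ ∙ x)) ⟩
    q ∙ (conj p x ∙ p ⁻¹)      ≈⟨ ∙-congˡ (∙-congʳ eq) ⟩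
    q ∙ (conj q x ∙ p ⁻¹)      ≈⟨ sym (assoc q (conj q x) (p ⁻¹)) ⟩
    q ∙ conj q x ∙ p ⁻¹        ≈⟨ ∙-congʳ (sym (assoc q (q ⁻¹ ∙ x) q)) ⟩
    q ∙ (q ⁻¹ ∙ x) ∙ q ∙ p ⁻¹  ≈⟨ ∙-congʳ (∙-congʳ (cancelˡ (inverseʳ q) x)) ⟩
    x ∙ q ∙ p ⁻¹               ≈⟨ assoc x q (p ⁻¹) ⟩
    x ∙ (q ∙ p ⁻¹)             ∎

module Evaluation {g ℓ} (G : Group g ℓ) where
  open Group G
  open GroupCommutation G
  open GroupProperties G using (⁻¹-anti-homo-∙)
  open SetoidReasoning setoid

  eval : ∀ {a} {A : Set a} → (A → Carrier) → Word A → Carrier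
  eval f (gen x) = f x
  eval f Word.ε = ε
  eval f (u · v) = eval f u ∙ eval f v
  eval f (u Word.⁻¹) = eval f u ⁻¹

  eval-mapWord : ∀ {a b} {A : Set a} {B : Set b} (f : B → Carrier) (h : A → B) w →
                 eval f (mapWord h w) ≡ eval (f ∘ h) w
  eval-mapWord f h (gen x) = ≡.refl
  eval-mapWord f h Word.ε = ≡.refl
  eval-mapWord f h (u · v) = ≡.cong₂ _∙_ (eval-mapWord f h u) (eval-mapWord f h v)
  eval-mapWord f h (u Word.⁻¹) = ≡.cong _⁻¹ (eval-mapWord f h u)

  module _ {a} {A : Set a} where

    commute-eval : ∀ {c} {f : A → Carrier} → (∀ x → Commute c (f x)) →
                   ∀ w → Commute c (eval f w)
    commute-eval hyp (gen x) = hyp x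
    commute-eval hyp Word.ε = commute-εʳ _
    commute-eval hyp (u · v) = commute-∙ʳ (commute-eval hyp u) (commute-eval hyp v)
    commute-eval hyp (u Word.⁻¹) = commute-⁻¹ʳ (commute-eval hyp u)

    commute-eval₂ : ∀ {f h : A → Carrier} → (∀ x y → Commute (f x) (h y)) →
                    ∀ u v → Commute (eval f u) (eval h v)
    commute-eval₂ hyp u v =
      commute-eval (λ y → commute-sym (commute-eval (λ x → commute-sym (hyp x y)) u)) v

    eval-pointwise-∙ : ∀ {f f₁ f₂ : A → Carrier} →
                       (∀ x y → Commute (f₂ x) (f₁ y)) → (∀ x → f x ≈ f₁ x ∙ f₂ x) →
                       ∀ w → eval f w ≈ eval f₁ w ∙ eval f₂ w
    eval-pointwise-∙ comm split (gen x) = split x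
    eval-pointwise-∙ comm split Word.ε = sym (identityʳ ε)
    eval-pointwise-∙ comm split (u · v) =
      trans (∙-cong (eval-pointwise-∙ comm split u) (eval-pointwise-∙ comm split v))
            (interchange _ _ _ _ (commute-eval₂ comm u v))
    eval-pointwise-∙ {f} {f₁} {f₂} comm split (u Word.⁻¹) = begin
      eval f u ⁻¹                     ≈⟨ ⁻¹-cong (eval-pointwise-∙ comm split u) ⟩
      (eval f₁ u ∙ eval f₂ u) ⁻¹      ≈⟨ ⁻¹-anti-homo-∙ (eval f₁ u) (eval f₂ u) ⟩
      eval f₂ u ⁻¹ ∙ eval f₁ u ⁻¹     ≈⟨ commute-⁻¹ (commute-eval₂ comm u u) ⟩
      eval f₁ u ⁻¹ ∙ eval f₂ u ⁻¹     ∎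

module StructureGroup {a} (Z : Rack a) where
  open Rack Z using (_^_)

  structureGroup : Group a a
  structureGroup = record
    { Carrier = Word (Rack.Carrier Z)
    ; _≈_ = _≈Γ_ Z
    ; _∙_ = _·_
    ; ε = Word.ε
    ; _⁻¹ = Word._⁻¹
    ; isGroup = record
      { isMonoid = record
        { isSemigroup = record
          { isMagma = record
            { isEquivalence = record { refl = Defs.≈refl ; sym = Defs.≈sym ; trans = Defs.≈trans }
            ; ∙-cong = Defs.·-cong
            }
          ; assoc = Defs.assoc
          }
        ; identity = Defs.idˡ , Defs.idʳ
        }
      ; inverse = Defs.invˡ , Defs.invʳ
      ; ⁻¹-cong = Defs.⁻¹-cong
      }
    }

  eval-gen : ∀ w → Evaluation.eval structureGroup gen w ≡ w
  eval-gen (gen x) = ≡.refl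
  eval-gen Word.ε = ≡.refl
  eval-gen (u · v) = ≡.cong₂ _·_ (eval-gen u) (eval-gen v)
  eval-gen (u Word.⁻¹) = ≡.cong Word._⁻¹ (eval-gen u)

  commute-gen⇒commute : ∀ {c} → (∀ x → GroupCommutation.Commute structureGroup c (gen x)) →
                        ∀ w → GroupCommutation.Commute structureGroup c w
  commute-gen⇒commute {c} hyp w =
    ≡.subst (GroupCommutation.Commute structureGroup c) (eval-gen w)
            (Evaluation.commute-eval structureGroup hyp w)

  module _ {g ℓ} (G : Group g ℓ) where
    open Group G
    open GroupCommutation G
    open Evaluation G
    open GroupProperties G using (ε⁻¹≈ε)

    RespectsRackRelations : (Rack.Carrier Z → Carrier) → Set (a ⊔ ℓ)
    RespectsRackRelations f = ∀ x y → f y ⁻¹ ∙ f x ∙ f y ≈ f (x ^ y)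

    module _ {f : Rack.Carrier Z → Carrier} (rel : RespectsRackRelations f) where

      eval-resp-≈Γ : ∀ {u v} → _≈Γ_ Z u v → eval f u ≈ eval f v
      eval-resp-≈Γ Defs.≈refl = refl
      eval-resp-≈Γ (Defs.≈sym e) = sym (eval-resp-≈Γ e)
      eval-resp-≈Γ (Defs.≈trans e e′) = trans (eval-resp-≈Γ e) (eval-resp-≈Γ e′)
      eval-resp-≈Γ (Defs.·-cong e e′) = ∙-cong (eval-resp-≈Γ e) (eval-resp-≈Γ e′)
      eval-resp-≈Γ (Defs.⁻¹-cong e) = ⁻¹-cong (eval-resp-≈Γ e)
      eval-resp-≈Γ (Defs.assoc u v w) = assoc _ _ _
      eval-resp-≈Γ (Defs.idˡ u) = identityˡ _
      eval-resp-≈Γ (Defs.idʳ u) = identityʳ _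
      eval-resp-≈Γ (Defs.invˡ u) = inverseˡ _
      eval-resp-≈Γ (Defs.invʳ u) = inverseʳ _
      eval-resp-≈Γ (Defs.rack-rel x y) = rel x y

      eval-InCommutator : (∀ x y → Commute (f x) (f y)) →
                          ∀ {w} → InCommutator Z w → eval f w ≈ ε
      eval-InCommutator comm (Defs.comm u v) =
        commute⇒commutator≈ε (commute-eval₂ comm u v)
      eval-InCommutator comm Defs.c-ε = refl
      eval-InCommutator comm (Defs.c-· h h′) =
        trans (∙-cong (eval-InCommutator comm h) (eval-InCommutator comm h′)) (identityˡ ε)
      eval-InCommutator comm (Defs.c-⁻¹ h) = trans (⁻¹-cong (eval-InCommutator comm h)) ε⁻¹≈ε
      eval-InCommutator comm (Defs.c-≈ e h) = trans (sym (eval-resp-≈Γ e)) (eval-InCommutator comm h)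

module ProductWithTrivial₂ {a} (X : Rack a) where
  open Rack X using (_^_)
  open Defs using (rack-rel)
  open StructureGroup
  private
    A = Rack.Carrier X

  R : Rack a
  R = X ×ᴿ trivialRack₂

  open Group (structureGroup R)
  open GroupCommutation (structureGroup R)
  open Evaluation (structureGroup R)
  open MonoidProperties monoid using (cancelʳ)
  open SetoidReasoning setoid

  t : A → Carrier
  t x = gen (x , true) ∙ gen (x , false) ⁻¹

  t-central : ∀ x w → Commute (t x) w
  t-central x = commute-gen⇒commute R λ { (y , i) → conj≈conj⇒commute
    (trans (rack-rel (y , i) (x , false)) (sym (rack-rel (y , i) (x , true)))) }

  t-^ : ∀ x y → t x ≈ t (x ^ y)
  t-^ x y = sym (begin
    gen (x ^ y , true) ∙ gen (x ^ y , false) ⁻¹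
      ≈⟨ ∙-cong (sym (rack-rel (x , true) c)) (⁻¹-cong (sym (rack-rel (x , false) c))) ⟩
    conj (gen c) (gen (x , true)) ∙ conj (gen c) (gen (x , false)) ⁻¹
      ≈⟨ ∙-congˡ (sym (conj-⁻¹ (gen c) (gen (x , false)))) ⟩
    conj (gen c) (gen (x , true)) ∙ conj (gen c) (gen (x , false) ⁻¹)
      ≈⟨ sym (conj-∙ (gen c) (gen (x , true)) (gen (x , false) ⁻¹)) ⟩
    conj (gen c) (t x)
      ≈⟨ conj-commute (t-central x (gen c)) ⟩
    t x ∎)
    where c = (y , false)

  τ : A × Bool → Carrier
  τ (x , false) = ε
  τ (x , true) = t x

  τ-central : ∀ p w → Commute (τ p) w
  τ-central (x , false) w = commute-sym (commute-εʳ w)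
  τ-central (x , true) w = t-central x w

  τ-respects : RespectsRackRelations R (structureGroup R) τ
  τ-respects (x , false) q = conj-commute (τ-central (x , false) (τ q))
  τ-respects (x , true) (y , j) = trans (conj-commute (t-central x (τ (y , j)))) (t-^ x y)

  s : A → Carrier
  s x = gen (x , false)

  s-respects : RespectsRackRelations X (structureGroup R) s
  s-respects x y = rack-rel (x , false) (y , false)

  gen≈τ∙s : ∀ p → gen p ≈ τ p ∙ s (proj₁ p)
  gen≈τ∙s (x , false) = sym (identityˡ (s x))
  gen≈τ∙s (x , true) = sym (cancelʳ (inverseˡ (s x)) (gen (x , true)))

  decompose : ∀ w → w ≈ eval τ w ∙ eval (s ∘ proj₁) w
  decompose w = begin
    w                                ≡⟨ ≡.sym (eval-gen R w) ⟩
    eval gen w                       ≈⟨ eval-pointwise-∙ (λ p q → commute-sym (τ-central q _)) gen≈τ∙s w ⟩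
    eval τ w ∙ eval (s ∘ proj₁) w    ∎

  commutator≈lift : ∀ {w} → InCommutator R w → w ≈ eval s (mapWord proj₁ w)
  commutator≈lift {w} hw = begin
    w                                ≈⟨ decompose w ⟩
    eval τ w ∙ eval (s ∘ proj₁) w    ≈⟨ ∙-congʳ (eval-InCommutator R (structureGroup R) τ-respects (λ p q → τ-central p (τ q)) hw) ⟩
    ε ∙ eval (s ∘ proj₁) w           ≈⟨ identityˡ _ ⟩
    eval (s ∘ proj₁) w               ≡⟨ ≡.sym (eval-mapWord s proj₁ w) ⟩
    eval s (mapWord proj₁ w)         ∎

mainTheorem10 : ∀ {a : Level} (X : Rack a) → Productive X trivialRack₂
mainTheorem10 X u v u∈[Γ,Γ] v∈[Γ,Γ] π₁u≈π₁v _ = begin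
  u                          ≈⟨ commutator≈lift u∈[Γ,Γ] ⟩
  eval s (mapWord proj₁ u)   ≈⟨ eval-resp-≈Γ X (structureGroup R) s-respects π₁u≈π₁v ⟩
  eval s (mapWord proj₁ v)   ≈⟨ sym (commutator≈lift v∈[Γ,Γ]) ⟩
  v                          ∎
  where
  open ProductWithTrivial₂ X
  open StructureGroup
  open Group (structureGroup R) using (sym; setoid)
  open Evaluation (structureGroup R) using (eval)
  open SetoidReasoning setoid
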